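{- For all $n\geq 0$, $s_n=D_{n-k}\widetilde{s}_nD_{n-k}^{ -1}$.
   Context: Fix $k\geq 2$, letters $a_1,\dots,a_k$ and positive integers $(d_i)_{i\geq1}$. Define $s_{1-k}=a_2,\dots,s_{ -1}=a_k,s_0=a_1$; $s_n=s_{n-1}^{d_n}\cdots s_0^{d_1}a_{n+1}$ for $1\leq n\leq k-1$; $s_n=s_{n-1}^{d_n}\cdots s_{n-k+1}^{d_{n-k+2}}s_{n-k}$ for $n\geq k$. Define $D_0=a_1^{d_1-1}$, $D_m=s_m^{d_{m+1}-1}s_{m-1}^{d_m}\cdots s_1^{d_2}s_0^{d_1}$ for $m\geq1$, and formally $D_{ -j}=a_{k+1-j}^{ -1}$ for $1\leq j\leq k$. Products involving inverse letters are computed in the free group on $\{a_1,\dots,a_k\}$. $\widetilde{w}$ denotes the reversal of the word $w$. -}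

module Defs where

open import Data.Nat using (ℕ; zero; suc; _+_; _∸_; _⊓_; _≤?_; _≡ᵇ_)
open import Data.Bool using (Bool; true; false; not; if_then_else_)
open import Data.Product using (_×_; _,_)
open import Data.List using (List; []; _∷_; [_]; _++_; map; reverse; concatMap; upTo)
open import Data.Integer using (ℤ; +_; -[1+_]; _⊖_)
open import Relation.Nullary using (yes; no)
open import Relation.Binary.Construct.Closure.Equivalence using (EqClosure)

-- The generator a_i is encoded by the natural number i (paper indices, 1-based).
-- A signed letter (i , true) stands for a_i, (i , false) for a_i⁻¹.
Letter : Set
Letter = ℕ × Bool

Word : Set
Word = List Letter

invL : Letter → Letter
invL (i , b) = (i , not b)

a : ℕ → Word
a i = [ (i , true) ]

_^ʷ_ : Word → ℕ → Word
w ^ʷ zero  = []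
w ^ʷ suc n = w ++ (w ^ʷ n)

inverse : Word → Word
inverse w = reverse (map invL w)

data Step : Word → Word → Set where
  cancel : ∀ p x q → Step (p ++ (x ∷ invL x ∷ q)) (p ++ q)

-- equality in the free group: equivalence closure of free cancellation
_≈ᶠ_ : Word → Word → Set
_≈ᶠ_ = EqClosure Step

range1 : ℕ → List ℕ
range1 c = map suc (upTo c)

module _ (k : ℕ) (d : ℕ → ℕ) where

  -- sAux fuel t  computes  s_{t+1-k}  (t : ℕ, so indices 1-k, 2-k, ... are covered);
  -- the fuel argument only serves termination (fuel t+1 suffices).
  sAux : ℕ → ℕ → Word
  sAux zero t = []
  sAux (suc f) t with suc t ≤? k
  ... | yes _ = if suc t ≡ᵇ k then a 1 else a (t + 2)
      -- t+1-k = -j with 1 ≤ j ≤ k-1 : s_{-j} = a_{k+1-j} = a_{t+2};  t+1 = k : s_0 = a_1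
  ... | no _  = concatMap (λ i → sAux f (t ∸ i) ^ʷ d (n ∸ i + 1)) (range1 (n ⊓ (k ∸ 1)))
                ++ last
    where
    n : ℕ
    n = suc t ∸ k
    -- product  s_{n-1}^{d_n} ⋯ s_{n-c}^{d_{n-c+1}}  with c = min(n, k-1), then
    -- a_{n+1} if n ≤ k-1, else s_{n-k}
    last : Word
    last with n ≤? (k ∸ 1)
    ... | yes _ = a (n + 1)
    ... | no _  = sAux f (t ∸ k)

  s : ℕ → Word
  s n = sAux (n + k) (n + k ∸ 1)

  D : ℤ → Word
  D (+ zero)  = a 1 ^ʷ (d 1 ∸ 1)
  D (+ suc m) = (s (suc m) ^ʷ (d (suc (suc m)) ∸ 1))
                ++ concatMap (λ i → s (suc m ∸ i) ^ʷ d (suc m ∸ i + 1)) (range1 (suc m))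
  -- D_{-(j+1)} = a_{k+1-(j+1)}⁻¹ = a_{k-j}⁻¹  (only used for j+1 ≤ k)
  D -[1+ j ]  = inverse (a (k ∸ j))

module Submission where

-- Write Q_m = s_{m-1}^{d_m} ⋯ s_0^{d_1}, so that D_m = s_m^{d_{m+1}-1} Q_m for m ≥ 0.
-- The recurrences read  s_n = Q_n a_{n+1}  for n < k, and
-- s_{k+j} = R s_j,  Q_{k+j} = R Q_{j+1}  (R the common first k-1 factors), hence
-- s_{k+j} D_j = R s_j^{d_{j+1}} Q_j = Q_{k+j}.                                  (∗)
-- By strong induction every word s_j^e Q_j is a palindrome: for j < k it has the shape
-- (q x)^e q with q = Q_j a palindrome and x a letter; for j = k+i, (∗) turns it into
-- s_j^{e+1} D_i, and w^e P is a palindrome whenever P and wP are.  In particular all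
-- Q_m and D_m are palindromes.  For n < k the claim is then one free cancellation
-- a_{n+1}⁻¹ a_{n+1} Q_n a_{n+1} → Q_n a_{n+1}; for n = k+j, reversing (∗) gives the
-- word identity D_j s̃_n = s_n D_j, and such an intertwining yields s_n = D_j s̃_n D_j⁻¹.

open import Defs
open import Data.Nat using (ℕ; _≤_)
open import Data.List using (_++_; reverse)
open import Data.Integer using (_⊖_)
open import Data.Nat using (zero; suc; _+_; _∸_; _⊓_; _<_; _≤?_; _≡ᵇ_; z≤n; s≤s)
open import Data.Nat.Properties
open import Data.Nat.Induction using (<-rec)
open import Data.Bool using (true; false; if_then_else_)
open import Data.Product using (_,_)
open import Data.List using ([]; _∷_; [_]; map; concat; concatMap; applyUpTo)
open import Data.List.Properties
  using (++-assoc; ++-identityʳ; reverse-++; unfold-reverse; map-upTo)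
open import Data.Integer using (+_; -_)
open import Data.Integer.Properties using (⊖-<; ⊖-≥)
open import Data.Bool.Properties using (T-≡)
open import Function.Bundles using (Equivalence)
open import Data.Empty using (⊥-elim)
open import Relation.Nullary using (¬_; Dec; yes; no)
open import Relation.Binary.PropositionalEquality
  using (_≡_; refl; sym; trans; cong; cong₂; subst; module ≡-Reasoning)
open import Relation.Binary.Construct.Closure.ReflexiveTransitive using (ε; _◅◅_)
open import Relation.Binary.Construct.Closure.Equivalence using (symmetric; return)

prod : (ℕ → Word) → ℕ → Word
prod g zero    = []
prod g (suc c) = g 0 ++ prod (λ i → g (suc i)) c

concatMap-range1 : ∀ (g : ℕ → Word) c → concatMap g (range1 c) ≡ prod (λ i → g (suc i)) c
concatMap-range1 g c = trans (cong (λ l → concat (map g l)) (map-upTo suc c)) (applied suc c)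
  where
  applied : ∀ (h : ℕ → ℕ) c → concat (map g (applyUpTo h c)) ≡ prod (λ i → g (h i)) c
  applied h zero    = refl
  applied h (suc c) = cong (g (h 0) ++_) (applied (λ i → h (suc i)) c)

prod-cong : ∀ (g h : ℕ → Word) c → (∀ i → i < c → g i ≡ h i) → prod g c ≡ prod h c
prod-cong g h zero    eq = refl
prod-cong g h (suc c) eq =
  cong₂ _++_ (eq 0 (s≤s z≤n)) (prod-cong _ _ c (λ i i<c → eq (suc i) (s≤s i<c)))

prod-+ : ∀ (g : ℕ → Word) b c → prod g (b + c) ≡ prod g b ++ prod (λ i → g (b + i)) c
prod-+ g zero    c = refl
prod-+ g (suc b) c =
  trans (cong (g 0 ++_) (prod-+ (λ i → g (suc i)) b c)) (sym (++-assoc (g 0) _ _))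

Palindrome : Word → Set
Palindrome w = reverse w ≡ w

^ʷ-comm : ∀ (w : Word) e → (w ^ʷ e) ++ w ≡ w ++ (w ^ʷ e)
^ʷ-comm w zero    = sym (++-identityʳ w)
^ʷ-comm w (suc e) = trans (++-assoc w (w ^ʷ e) w) (cong (w ++_) (^ʷ-comm w e))

reverse-^ʷ : ∀ (w : Word) e → reverse (w ^ʷ e) ≡ reverse w ^ʷ e
reverse-^ʷ w zero    = refl
reverse-^ʷ w (suc e) = begin
  reverse (w ++ (w ^ʷ e))           ≡⟨ reverse-++ w (w ^ʷ e) ⟩
  reverse (w ^ʷ e) ++ reverse w     ≡⟨ cong (_++ reverse w) (reverse-^ʷ w e) ⟩
  (reverse w ^ʷ e) ++ reverse w     ≡⟨ ^ʷ-comm (reverse w) e ⟩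
  reverse w ++ (reverse w ^ʷ e)     ∎
  where open ≡-Reasoning

^ʷ-slide : ∀ (w P : Word) → P ++ reverse w ≡ w ++ P →
           ∀ e → (w ^ʷ e) ++ P ≡ P ++ (reverse w ^ʷ e)
^ʷ-slide w P slide zero    = sym (++-identityʳ P)
^ʷ-slide w P slide (suc e) = begin
  (w ++ (w ^ʷ e)) ++ P                 ≡⟨ ++-assoc w _ P ⟩
  w ++ ((w ^ʷ e) ++ P)                 ≡⟨ cong (w ++_) (^ʷ-slide w P slide e) ⟩
  w ++ (P ++ (reverse w ^ʷ e))         ≡⟨ sym (++-assoc w P _) ⟩
  (w ++ P) ++ (reverse w ^ʷ e)         ≡⟨ cong (_++ (reverse w ^ʷ e)) (sym slide) ⟩
  (P ++ reverse w) ++ (reverse w ^ʷ e) ≡⟨ ++-assoc P _ _ ⟩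
  P ++ (reverse w ++ (reverse w ^ʷ e)) ∎
  where open ≡-Reasoning

palindrome-powers : ∀ (w P : Word) → Palindrome P → Palindrome (w ++ P) →
                    ∀ e → Palindrome ((w ^ʷ e) ++ P)
palindrome-powers w P palP palwP e = begin
  reverse ((w ^ʷ e) ++ P)        ≡⟨ reverse-++ (w ^ʷ e) P ⟩
  reverse P ++ reverse (w ^ʷ e)  ≡⟨ cong₂ _++_ palP (reverse-^ʷ w e) ⟩
  P ++ (reverse w ^ʷ e)          ≡⟨ sym (^ʷ-slide w P slide e) ⟩
  (w ^ʷ e) ++ P                  ∎
  where
  open ≡-Reasoning
  slide : P ++ reverse w ≡ w ++ P
  slide = trans (cong (_++ reverse w) (sym palP)) (trans (sym (reverse-++ w P)) palwP)

palindrome-sandwich : ∀ (q u : Word) → Palindrome q → Palindrome u →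
                      Palindrome ((q ++ u) ++ q)
palindrome-sandwich q u palq palu = begin
  reverse ((q ++ u) ++ q)         ≡⟨ reverse-++ (q ++ u) q ⟩
  reverse q ++ reverse (q ++ u)   ≡⟨ cong (reverse q ++_) (reverse-++ q u) ⟩
  reverse q ++ (reverse u ++ reverse q) ≡⟨ cong₂ (λ x y → x ++ (y ++ x)) palq palu ⟩
  q ++ (u ++ q)                   ≡⟨ sym (++-assoc q u q) ⟩
  (q ++ u) ++ q                   ∎
  where open ≡-Reasoning

≡⇒≈ᶠ : ∀ {u v : Word} → u ≡ v → u ≈ᶠ v
≡⇒≈ᶠ refl = ε

cancel-inverse : ∀ (D w r : Word) → (w ++ (D ++ (inverse D ++ r))) ≈ᶠ (w ++ r)
cancel-inverse []      w r = ε
cancel-inverse (x ∷ D) w r =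
  ≡⇒≈ᶠ regroup ◅◅ cancel-inverse D (w ++ [ x ]) (invL x ∷ r)
    ◅◅ ≡⇒≈ᶠ (++-assoc w [ x ] _) ◅◅ return (cancel w x r)
  where
  open ≡-Reasoning
  regroup : w ++ ((x ∷ D) ++ (inverse (x ∷ D) ++ r))
          ≡ (w ++ [ x ]) ++ (D ++ (inverse D ++ (invL x ∷ r)))
  regroup = begin
    w ++ (x ∷ D ++ (reverse (invL x ∷ map invL D) ++ r))
      ≡⟨ cong (λ z → w ++ (x ∷ D ++ (z ++ r))) (unfold-reverse (invL x) (map invL D)) ⟩
    w ++ (x ∷ D ++ ((inverse D ++ [ invL x ]) ++ r))
      ≡⟨ cong (λ z → w ++ (x ∷ D ++ z)) (++-assoc (inverse D) [ invL x ] r) ⟩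
    w ++ ([ x ] ++ (D ++ (inverse D ++ (invL x ∷ r))))
      ≡⟨ sym (++-assoc w [ x ] _) ⟩
    (w ++ [ x ]) ++ (D ++ (inverse D ++ (invL x ∷ r))) ∎

intertwining⇒conjugate : ∀ {u v : Word} (D : Word) → D ++ v ≡ u ++ D →
                         u ≈ᶠ (D ++ (v ++ inverse D))
intertwining⇒conjugate {u} {v} D intertwine = symmetric Step
  (≡⇒≈ᶠ regroup ◅◅ cancel-inverse D u [] ◅◅ ≡⇒≈ᶠ (++-identityʳ u))
  where
  open ≡-Reasoning
  regroup : D ++ (v ++ inverse D) ≡ u ++ (D ++ (inverse D ++ []))
  regroup = begin
    D ++ (v ++ inverse D)            ≡⟨ sym (++-assoc D v _) ⟩
    (D ++ v) ++ inverse D            ≡⟨ cong (_++ inverse D) intertwine ⟩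
    (u ++ D) ++ inverse D            ≡⟨ ++-assoc u D _ ⟩
    u ++ (D ++ inverse D)            ≡⟨ cong (λ z → u ++ (D ++ z)) (sym (++-identityʳ _)) ⟩
    u ++ (D ++ (inverse D ++ []))    ∎

-- Throughout, k = K + 1 (the proposition only needs k ≥ 1).
module Recurrence (K : ℕ) (d : ℕ → ℕ) where

  k : ℕ
  k = suc K

  sA : ℕ → ℕ → Word
  sA = sAux k d

  -- The i-th factor s_{n-1-i}^{d_{n-i}} in the unfolding of sAux f t = s_n (n = t+1-k).
  unfolded : ℕ → ℕ → ℕ → Word
  unfolded f t i = sA f (t ∸ suc i) ^ʷ d (t ∸ K ∸ suc i + 1)

  sAux-initial : ∀ f t → suc t ≤ k → sA (suc f) t ≡ (if suc t ≡ᵇ k then a 1 else a (t + 2))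
  sAux-initial f t t<k with suc t ≤? k
  ... | yes _  = refl
  ... | no t≮k = ⊥-elim (t≮k t<k)

  sAux-short : ∀ f t → ¬ (suc t ≤ k) → t ∸ K ≤ K →
    sA (suc f) t ≡ prod (unfolded f t) (t ∸ K) ++ a (t ∸ K + 1)
  sAux-short f t t≮k short with suc t ≤? k
  ... | yes t<k = ⊥-elim (t≮k t<k)
  ... | no _ with t ∸ K ≤? K
  ... | no long = ⊥-elim (long short)
  ... | yes _   = cong (_++ a (t ∸ K + 1))
    (trans (concatMap-range1 (λ i → sA f (t ∸ i) ^ʷ d (t ∸ K ∸ i + 1)) ((t ∸ K) ⊓ K))
           (cong (prod _) (m≤n⇒m⊓n≡m short)))

  sAux-long : ∀ f t → ¬ (suc t ≤ k) → ¬ (t ∸ K ≤ K) →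
    sA (suc f) t ≡ prod (unfolded f t) K ++ sA f (t ∸ k)
  sAux-long f t t≮k long with suc t ≤? k
  ... | yes t<k = ⊥-elim (t≮k t<k)
  ... | no _ with t ∸ K ≤? K
  ... | yes short = ⊥-elim (long short)
  ... | no _      = cong (_++ sA f (t ∸ k))
    (trans (concatMap-range1 (λ i → sA f (t ∸ i) ^ʷ d (t ∸ K ∸ i + 1)) ((t ∸ K) ⊓ K))
           (cong (prod _) (m≥n⇒m⊓n≡n (<⇒≤ (≰⇒> long)))))

  earlier-index : ∀ {t} → ¬ (suc t ≤ k) → ∀ i → t ∸ suc i < t
  earlier-index {zero}  t≮k i = ⊥-elim (t≮k (s≤s z≤n))
  earlier-index {suc t} _   i = s≤s (m∸n≤m t i)

  sAux-fuel : ∀ f g t → suc t ≤ f → suc t ≤ g → sA f t ≡ sA g t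
  sAux-fuel (suc f) (suc g) t (s≤s t<f) (s≤s t<g) = by-branch (suc t ≤? k) (t ∸ K ≤? K)
    where
    earlier : ∀ {u} → u < t → sA f u ≡ sA g u
    earlier u<t = sAux-fuel f g _ (≤-trans u<t t<f) (≤-trans u<t t<g)
    factors : ∀ c → ¬ (suc t ≤ k) →
      prod (unfolded f t) c ≡ prod (unfolded g t) c
    factors c t≮k = prod-cong _ _ c (λ i _ →
      cong (_^ʷ d (t ∸ K ∸ suc i + 1)) (earlier (earlier-index t≮k i)))
    by-branch : Dec (suc t ≤ k) → Dec (t ∸ K ≤ K) → sA (suc f) t ≡ sA (suc g) t
    by-branch (yes t<k) _ = trans (sAux-initial f t t<k) (sym (sAux-initial g t t<k))
    by-branch (no t≮k) (yes short) = trans (sAux-short f t t≮k short)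
      (trans (cong (_++ a (t ∸ K + 1)) (factors (t ∸ K) t≮k))
             (sym (sAux-short g t t≮k short)))
    by-branch (no t≮k) (no long) = trans (sAux-long f t t≮k long)
      (trans (cong₂ _++_ (factors K t≮k) (earlier (earlier-index t≮k K)))
             (sym (sAux-long g t t≮k long)))

  S : ℕ → Word
  S = s k d

  factor : ℕ → ℕ → Word
  factor m i = S (m ∸ suc i) ^ʷ d (m ∸ suc i + 1)

  -- Q_m = s_{m-1}^{d_m} ⋯ s_0^{d_1}; note Q_{j+1} = s_j^{d_{j+1}} Q_j definitionally.
  Q : ℕ → Word
  Q m = prod (factor m) m

  D⁺ : ℕ → Word
  D⁺ j = (S j ^ʷ (d (j + 1) ∸ 1)) ++ Q j

  s-as-sAux : ∀ m → S m ≡ sA (suc (m + K)) (m + K)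
  s-as-sAux m rewrite +-suc m K = refl

  unfolded-factor : ∀ m i → suc i ≤ m → unfolded (m + K) (m + K) i ≡ factor m i
  unfolded-factor m i i<m =
    cong₂ _^ʷ_ earlier-s (cong (λ z → d (z ∸ suc i + 1)) (m+n∸n≡m m K))
    where
    open ≡-Reasoning
    earlier-s : sA (m + K) (m + K ∸ suc i) ≡ S (m ∸ suc i)
    earlier-s = begin
      sA (m + K) (m + K ∸ suc i)
        ≡⟨ cong (sA (m + K)) (+-∸-comm K i<m) ⟩
      sA (m + K) (m ∸ suc i + K)
        ≡⟨ sAux-fuel (m + K) (suc (m ∸ suc i + K)) (m ∸ suc i + K)
             (+-monoˡ-≤ K (∸-monoʳ-< (s≤s z≤n) i<m)) ≤-refl ⟩
      sA (suc (m ∸ suc i + K)) (m ∸ suc i + K)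
        ≡⟨ sym (s-as-sAux (m ∸ suc i)) ⟩
      S (m ∸ suc i) ∎

  s-initial : ∀ m → m ≤ K → S m ≡ Q m ++ a (suc m)
  s-initial zero _ = trans (s-as-sAux 0)
    (trans (sAux-initial K K ≤-refl)
           (cong (if_then a 1 else a (K + 2)) (Equivalence.to T-≡ (≡⇒≡ᵇ K K refl))))
  s-initial m@(suc n) m≤K = trans (s-as-sAux m)
    (trans (sAux-short (m + K) (m + K) not-initial short)
      (cong₂ _++_ (trans (cong (prod _) drop-K) (prod-cong _ _ m (unfolded-factor m)))
                  (cong a (trans (cong (_+ 1) drop-K) (+-comm m 1)))))
    where
    drop-K : m + K ∸ K ≡ m
    drop-K = m+n∸n≡m m K
    not-initial : ¬ (suc (m + K) ≤ k)
    not-initial m+K<k = 1+n≰n (≤-trans (s≤s (m≤n+m K n)) (≤-pred m+K<k))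
    short : m + K ∸ K ≤ K
    short = subst (_≤ K) (sym drop-K) m≤K

  s-recurrent : ∀ j → S (k + j) ≡ prod (factor (k + j)) K ++ S j
  s-recurrent j = trans (s-as-sAux m)
    (trans (sAux-long (m + K) (m + K) not-initial long)
      (cong₂ _++_ (prod-cong _ _ K (λ i i<K → unfolded-factor m i (≤-trans i<K K<m)))
                  last-is-s))
    where
    m : ℕ
    m = k + j
    K<m : K ≤ m
    K<m = ≤-trans (n≤1+n K) (m≤m+n k j)
    drop-K : m + K ∸ K ≡ m
    drop-K = m+n∸n≡m m K
    not-initial : ¬ (suc (m + K) ≤ k)
    not-initial m+K<k = 1+n≰n (≤-trans (+-monoˡ-≤ K (s≤s z≤n)) (≤-pred m+K<k))
    long : ¬ (m + K ∸ K ≤ K)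
    long short = 1+n≰n (≤-trans (m≤m+n k j) (subst (_≤ K) drop-K short))
    drop-k : m + K ∸ k ≡ j + K
    drop-k = trans (cong (_∸ k) (+-assoc k j K)) (m+n∸m≡n k (j + K))
    last-is-s : sA (m + K) (m + K ∸ k) ≡ S j
    last-is-s = trans (cong (sA (m + K)) drop-k)
      (trans (sAux-fuel (m + K) (suc (j + K)) (j + K)
                (subst (suc (j + K) ≤_) (sym (+-assoc k j K)) (s≤s (m≤n+m (j + K) K))) ≤-refl)
             (sym (s-as-sAux j)))

  Q-recurrent : ∀ j → Q (k + j) ≡ prod (factor (k + j)) K ++ Q (suc j)
  Q-recurrent j = trans (cong (prod (factor m)) (sym (+-suc K j)))
    (trans (prod-+ (factor m) K (suc j))
           (cong (prod (factor m) K ++_) (prod-cong _ _ (suc j) (λ i _ → shifted i))))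
    where
    m : ℕ
    m = k + j
    shifted : ∀ i → factor m (K + i) ≡ factor (suc j) i
    shifted i = cong (λ z → S z ^ʷ d (z + 1)) ([m+n]∸[m+o]≡n∸o K j i)

  D-nonnegative : ∀ j → D k d (+ j) ≡ D⁺ j
  D-nonnegative zero    =
    trans (cong (_^ʷ (d 1 ∸ 1)) (sym (s-initial 0 z≤n))) (sym (++-identityʳ _))
  D-nonnegative (suc m) =
    cong₂ _++_ (cong (λ z → S (suc m) ^ʷ (d z ∸ 1)) (+-comm 1 (suc m)))
               (concatMap-range1 (λ i → S (suc m ∸ i) ^ʷ d (suc m ∸ i + 1)) (suc m))

  D-negative : ∀ n → n ≤ K → D k d (n ⊖ k) ≡ [ (suc n , false) ]
  D-negative n n≤K = begin
    D k d (n ⊖ k)                  ≡⟨ cong (D k d) (⊖-< (s≤s n≤K)) ⟩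
    D k d (- (+ (suc K ∸ n)))      ≡⟨ cong (λ z → D k d (- (+ z))) (+-∸-assoc 1 n≤K) ⟩
    inverse (a (suc K ∸ (K ∸ n)))  ≡⟨ cong (λ z → inverse (a z)) index ⟩
    [ (suc n , false) ]            ∎
    where
    open ≡-Reasoning
    index : suc K ∸ (K ∸ n) ≡ suc n
    index = trans (+-∸-assoc 1 (m∸n≤m K n)) (cong suc (m∸[m∸n]≡n n≤K))

  s-recurrent-D : ∀ j → 1 ≤ d (j + 1) → S (k + j) ++ D⁺ j ≡ Q (k + j)
  s-recurrent-D j d≥1 = begin
    S (k + j) ++ D⁺ j
      ≡⟨ cong (_++ D⁺ j) (s-recurrent j) ⟩
    (R ++ S j) ++ D⁺ j
      ≡⟨ ++-assoc R (S j) (D⁺ j) ⟩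
    R ++ (S j ++ ((S j ^ʷ (d (j + 1) ∸ 1)) ++ Q j))
      ≡⟨ cong (R ++_) (sym (++-assoc (S j) _ (Q j))) ⟩
    R ++ ((S j ^ʷ suc (d (j + 1) ∸ 1)) ++ Q j)
      ≡⟨ cong (λ e → R ++ ((S j ^ʷ e) ++ Q j)) (trans (+-comm 1 _) (m∸n+n≡m d≥1)) ⟩
    R ++ Q (suc j)
      ≡⟨ sym (Q-recurrent j) ⟩
    Q (k + j) ∎
    where
    open ≡-Reasoning
    R : Word
    R = prod (factor (k + j)) K

  data Phase : ℕ → Set where
    initial   : ∀ {n} → n ≤ K → Phase n
    recurrent : ∀ j → Phase (k + j)

  phase : ∀ n → Phase n
  phase n with n ≤? K
  ... | yes n≤K = initial n≤K
  ... | no  n≰K = subst Phase (m+[n∸m]≡n (≰⇒> n≰K)) (recurrent (n ∸ k))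

  -- The palindrome invariant: every s_j^e Q_j is a palindrome.  Taking e = d_{j+1}
  -- and e = d_{j+1} - 1 shows that Q_{j+1} and D_j are palindromes.
  PalindromicPowers : ℕ → Set
  PalindromicPowers j = ∀ e → Palindrome ((S j ^ʷ e) ++ Q j)

  -- Q_j is a palindrome once the invariant holds below j (Q_{j+1} = s_j^{d_{j+1}} Q_j).
  Q-palindrome : ∀ j → (∀ {i} → i < j → PalindromicPowers i) → Palindrome (Q j)
  Q-palindrome zero    _  = refl
  Q-palindrome (suc j) ih = ih ≤-refl (d (j + 1))

  module _ (d-positive : ∀ i → 1 ≤ i → 1 ≤ d i) where

    -- Needed to write s_j^{d_{j+1}} = s_j s_j^{d_{j+1}-1} in (∗).
    d-successor-positive : ∀ j → 1 ≤ d (j + 1)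
    d-successor-positive j = d-positive (j + 1) (m≤n+m 1 j)

    -- Induction step: for j < k, s_j^e Q_j = (Q_j a_{j+1})^e Q_j; for j = k+i,
    -- s_j^e Q_j = s_j^{e+1} D_i by (∗), where D_i and s_j D_i = Q_j are palindromes.
    palindromic-powers-step : ∀ {j} → Phase j →
      (∀ {i} → i < j → PalindromicPowers i) → PalindromicPowers j
    palindromic-powers-step {j} (initial j≤K) ih e =
      subst (λ w → Palindrome ((w ^ʷ e) ++ Q j)) (sym (s-initial j j≤K))
        (palindrome-powers (Q j ++ a (suc j)) (Q j) palQ
           (palindrome-sandwich (Q j) (a (suc j)) palQ refl) e)
      where
      palQ : Palindrome (Q j)
      palQ = Q-palindrome j ih
    palindromic-powers-step (recurrent i) ih e =
      subst Palindrome shift (palindrome-powers (S j) (D⁺ i) palD palSD (suc e))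
      where
      j : ℕ
      j = k + i
      key : S j ++ D⁺ i ≡ Q j
      key = s-recurrent-D i (d-successor-positive i)
      palD : Palindrome (D⁺ i)
      palD = ih (s≤s (m≤n+m i K)) (d (i + 1) ∸ 1)
      palSD : Palindrome (S j ++ D⁺ i)
      palSD = subst Palindrome (sym key) (Q-palindrome j ih)
      shift : (S j ^ʷ suc e) ++ D⁺ i ≡ (S j ^ʷ e) ++ Q j
      shift = begin
        (S j ++ (S j ^ʷ e)) ++ D⁺ i ≡⟨ cong (_++ D⁺ i) (sym (^ʷ-comm (S j) e)) ⟩
        ((S j ^ʷ e) ++ S j) ++ D⁺ i ≡⟨ ++-assoc (S j ^ʷ e) (S j) (D⁺ i) ⟩
        (S j ^ʷ e) ++ (S j ++ D⁺ i) ≡⟨ cong ((S j ^ʷ e) ++_) key ⟩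
        (S j ^ʷ e) ++ Q j           ∎
        where open ≡-Reasoning

    palindromic-powers : ∀ j → PalindromicPowers j
    palindromic-powers = <-rec PalindromicPowers (λ j → palindromic-powers-step (phase j))

    Q-palindromic : ∀ m → Palindrome (Q m)
    Q-palindromic m = Q-palindrome m (λ {i} _ → palindromic-powers i)

    D⁺-palindromic : ∀ j → Palindrome (D⁺ j)
    D⁺-palindromic j = palindromic-powers j (d (j + 1) ∸ 1)

    self-conjugate : ∀ {n} → Phase n →
      S n ≈ᶠ (D k d (n ⊖ k) ++ (reverse (S n) ++ inverse (D k d (n ⊖ k))))
    -- For n < k the right-hand side is a_{n+1}⁻¹ a_{n+1} Q_n a_{n+1}: one cancellation.
    self-conjugate {n} (initial n≤K) rewrite D-negative n n≤K =
      symmetric Step (≡⇒≈ᶠ unfold ◅◅ return (cancel [] (suc n , false) (Q n ++ a (suc n)))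
                      ◅◅ ≡⇒≈ᶠ (sym (s-initial n n≤K)))
      where
      reverse-s : reverse (S n) ≡ a (suc n) ++ Q n
      reverse-s = trans (cong reverse (s-initial n n≤K))
        (trans (reverse-++ (Q n) (a (suc n)))
               (cong (a (suc n) ++_) (Q-palindromic n)))
      unfold : (suc n , false) ∷ (reverse (S n) ++ a (suc n))
             ≡ (suc n , false) ∷ (suc n , true) ∷ (Q n ++ a (suc n))
      unfold = cong (λ w → (suc n , false) ∷ (w ++ a (suc n))) reverse-s
    self-conjugate (recurrent j) =
      subst (λ w → S n ≈ᶠ (w ++ (reverse (S n) ++ inverse w))) (sym D-eq)
        (intertwining⇒conjugate (D⁺ j) intertwine)
      where
      open ≡-Reasoning
      n : ℕ
      n = k + j
      key : S n ++ D⁺ j ≡ Q n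
      key = s-recurrent-D j (d-successor-positive j)
      D-eq : D k d (n ⊖ k) ≡ D⁺ j
      D-eq = trans (cong (D k d) (trans (⊖-≥ (m≤m+n k j)) (cong +_ (m+n∸m≡n k j))))
                   (D-nonnegative j)
      -- Reversing (∗), using that D_j and Q_n are palindromes.
      intertwine : D⁺ j ++ reverse (S n) ≡ S n ++ D⁺ j
      intertwine = begin
        D⁺ j ++ reverse (S n)           ≡⟨ cong (_++ reverse (S n)) (sym (D⁺-palindromic j)) ⟩
        reverse (D⁺ j) ++ reverse (S n) ≡⟨ sym (reverse-++ (S n) (D⁺ j)) ⟩
        reverse (S n ++ D⁺ j)           ≡⟨ cong reverse key ⟩
        reverse (Q n)                   ≡⟨ Q-palindromic n ⟩
        Q n                             ≡⟨ sym key ⟩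
        S n ++ D⁺ j                     ∎

proposition4p5 : (k : ℕ) → 2 ≤ k → (d : ℕ → ℕ) → (∀ i → 1 ≤ i → 1 ≤ d i) →
    (n : ℕ) → s k d n ≈ᶠ (D k d (n ⊖ k) ++ (reverse (s k d n) ++ inverse (D k d (n ⊖ k))))
proposition4p5 zero    ()
proposition4p5 (suc K) _ d d-positive n =
  Recurrence.self-conjugate K d d-positive (Recurrence.phase K d n)
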